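{- For $m\ge1$ let $Z_m=\sum_{\epsilon\in\{ -1,0,1\}^m,\ \epsilon\neq\vec 0}[\vec0,\epsilon]\subset\mathbb{R}^m$ (Minkowski sum of segments). Let $n\ge2$, let $e_i$ be a standard basis vector of $\mathbb{R}^n$, let $H_i=\{x\in\mathbb{R}^n:\langle e_i,x\rangle=0\}$, and let $Z'$ denote $Z_{n-1}$ embedded into $H_i$ (i.e. placed in the coordinates other than the $i$th, with $i$th coordinate $0$). (1) The face $F_i=\{z\in Z_n:\langle e_i,z\rangle=\max\{\langle e_i,x\rangle:x\in Z_n\}\}$ is a translate of $Z'$. (2) The section $X=\{z\in Z_n:\langle e_i,z\rangle=0\}$ equals $3Z'$.
   Context: $[\vec0,\epsilon]$ denotes the line segment from the origin to $\epsilon$.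
   Formalization: Stated over ℚ^n rather than ℝ^n: the points of $Z_m$, $F_i$, $X$ and $Z'$, the segment coefficients and the translation vector are all rational. -}

module Defs where

open import Data.Nat using (ℕ; zero; suc)
open import Data.Fin using (Fin; zero; suc; punchOut)
open import Data.Fin.Properties using (_≟_)
open import Data.Bool using (Bool; true; false; _∨_)
open import Data.List using (List; []; _∷_; map; concatMap; filterᵇ; length; lookup)
open import Data.Integer using (+_)
open import Data.Rational using (ℚ; 0ℚ; 1ℚ; -_; _+_; _*_; _≤_; _/_)
open import Data.Product using (Σ; _×_; ∃)
open import Relation.Binary.PropositionalEquality using (_≡_)
open import Relation.Nullary using (yes; no)

Pt : ℕ → Set
Pt m = Fin m → ℚ

sumFin : {k : ℕ} → (Fin k → ℚ) → ℚ
sumFin {zero}  f = 0ℚ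
sumFin {suc k} f = f zero + sumFin (λ j → f (suc j))

⟨_,_⟩ : {m : ℕ} → Pt m → Pt m → ℚ
⟨ x , y ⟩ = sumFin (λ j → x j * y j)

e : {m : ℕ} → Fin m → Pt m
e i j with i ≟ j
... | yes _ = 1ℚ
... | no  _ = 0ℚ

data Tri : Set where
  neg zer pos : Tri

val : Tri → ℚ
val neg = - 1ℚ
val zer = 0ℚ
val pos = 1ℚ

isNonzero : Tri → Bool
isNonzero zer = false
isNonzero _   = true

cons : {m : ℕ} → Tri → (Fin m → Tri) → Fin (suc m) → Tri
cons t f zero    = t
cons t f (suc j) = f j

allTri : (m : ℕ) → List (Fin m → Tri)
allTri zero    = (λ ()) ∷ []
allTri (suc m) = concatMap (λ t → map (cons t) (allTri m)) (neg ∷ zer ∷ pos ∷ [])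

anyNonzero : {m : ℕ} → (Fin m → Tri) → Bool
anyNonzero {zero}  f = false
anyNonzero {suc m} f = isNonzero (f zero) ∨ anyNonzero (λ j → f (suc j))

gens : (m : ℕ) → List (Fin m → Tri)
gens m = filterᵇ anyNonzero (allTri m)

gen : (m : ℕ) → Fin (length (gens m)) → Pt m
gen m k j = val (lookup (gens m) k j)

InZ : (m : ℕ) → Pt m → Set
InZ m x = Σ (Fin (length (gens m)) → ℚ) λ t →
  ((k : Fin (length (gens m))) → (0ℚ ≤ t k) × (t k ≤ 1ℚ)) ×
  ((j : Fin m) → x j ≡ sumFin (λ k → t k * gen m k j))

embed : {n : ℕ} → Fin (suc n) → Pt n → Pt (suc n)
embed i y j with i ≟ j
... | yes _  = 0ℚ
... | no i≢j = y (punchOut i≢j)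

InZ' : {n : ℕ} → Fin (suc n) → Pt (suc n) → Set
InZ' {n} i z = Σ (Pt n) λ y → InZ n y × ((j : Fin (suc n)) → z j ≡ embed i y j)

InFace : {n : ℕ} → Fin n → Pt n → Set
InFace {n} i z = InZ n z × ((x : Pt n) → InZ n x → ⟨ e i , x ⟩ ≤ ⟨ e i , z ⟩)

InSection : {n : ℕ} → Fin n → Pt n → Set
InSection {n} i z = InZ n z × (⟨ e i , z ⟩ ≡ 0ℚ)

three : ℚ
three = (+ 3) / 1

-- Sort the generators ε ∈ {-1,0,1}^(n+1) of Z_(n+1) by their i-th entry t ∈ {-1,0,1}. In the other
-- coordinates each class is a copy of {-1,0,1}^n, so a point of Z_(n+1) has i-th coordinate s₊ - s₋ and
-- remaining coordinates y₋ + y₀ + y₊, where y_t ∈ Z_n is written with coefficients of total weight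
-- s_t ∈ [0, 3^n]. Hence x_i ≤ 3^n, with equality exactly when every coefficient of the class t = -1 is 0
-- and every coefficient of the class t = 1 is 1; this is the face (3^n, Σε) + Z'. On the section,
-- y₋ + y₀ + y₊ is three times the mean of three points of Z_n, which lies in Z_n by convexity; conversely
-- 3w = w + w + w with s₋ = s₀ = s₊.
module Submission where

open import Defs
open import Data.Nat using (ℕ; zero; suc)
open import Data.Fin using (Fin; zero; suc; punchIn; punchOut)
open import Data.Fin.Properties using (_≟_; punchIn-punchOut; suc-injective)
open import Data.List using (List; []; _∷_; _++_; map; concatMap; filterᵇ; length; lookup)
open import Data.Bool using (Bool; true; false)
import Data.List.Properties as List
open import Data.List.Relation.Binary.Permutation.Propositional
  using (_↭_; prep; swap; ↭-refl; ↭-sym; ↭-trans; ↭-reflexive; module PermutationReasoning)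
import Data.List.Relation.Binary.Permutation.Propositional as ↭
open import Data.List.Relation.Binary.Permutation.Propositional.Properties
  using (++⁺ˡ; ++⁺; shifts; map⁺)
open import Data.List.Relation.Binary.Pointwise using (Pointwise; []; _∷_)
open import Data.Product using (Σ; Σ-syntax; _×_; _,_; proj₁; proj₂)
import Data.Integer as ℤ
open import Data.Rational using (ℚ; 0ℚ; 1ℚ; -_; _+_; _*_; _-_; _/_; _≤_; NonNegative; nonNegative)
import Data.Rational.Properties as ℚ
open import Data.Rational.Solver using (module +-*-Solver)
open +-*-Solver using (solve; con; _:+_; _:*_; _:-_; _:=_)
open import Algebra.Bundles using (CommutativeMonoid)
open import Algebra.Properties.CommutativeSemigroup
  (CommutativeMonoid.commutativeSemigroup ℚ.+-0-commutativeMonoid) using (x∙yz≈y∙xz)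
open import Data.Vec.Functional using (insertAt; removeAt)
open import Data.Vec.Functional.Properties using (insertAt-lookup; insertAt-punchIn)
open import Relation.Binary.PropositionalEquality
open import Relation.Nullary using (yes; no; contradiction)
open import Function using (_∘_; _⇔_; mk⇔; Equivalence)

≗-by-punchIn : {A : Set} {n : ℕ} (i : Fin (suc n)) {x y : Fin (suc n) → A} →
  x i ≡ y i → (∀ k → x (punchIn i k) ≡ y (punchIn i k)) → x ≗ y
≗-by-punchIn i {x} {y} xᵢ≡yᵢ off j with i ≟ j
... | yes refl = xᵢ≡yᵢ
... | no i≢j   = subst (λ j → x j ≡ y j) (punchIn-punchOut i≢j) (off (punchOut i≢j))

embed≗insertAt : {n : ℕ} (i : Fin (suc n)) (y : Pt n) → embed i y ≗ insertAt y i 0ℚ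
embed≗insertAt i y j with i ≟ j
... | yes refl = sym (insertAt-lookup y i 0ℚ)
... | no i≢j   = begin
  y (punchOut i≢j)                               ≡⟨ insertAt-punchIn y i 0ℚ (punchOut i≢j) ⟨
  insertAt y i 0ℚ (punchIn i (punchOut i≢j))     ≡⟨ cong (insertAt y i 0ℚ) (punchIn-punchOut i≢j) ⟩
  insertAt y i 0ℚ j                              ∎
  where open ≡-Reasoning

embed-lookup : {n : ℕ} (i : Fin (suc n)) (y : Pt n) → embed i y i ≡ 0ℚ
embed-lookup i y = trans (embed≗insertAt i y i) (insertAt-lookup y i 0ℚ)

embed-punchIn : {n : ℕ} (i : Fin (suc n)) (y : Pt n) (k : Fin n) → embed i y (punchIn i k) ≡ y k
embed-punchIn i y k = trans (embed≗insertAt i y (punchIn i k)) (insertAt-punchIn y i 0ℚ k)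

sumFin-0 : {m : ℕ} (f : Fin m → ℚ) → (∀ j → f j ≡ 0ℚ) → sumFin f ≡ 0ℚ
sumFin-0 {zero}  f f≡0 = refl
sumFin-0 {suc m} f f≡0 = cong₂ _+_ (f≡0 zero) (sumFin-0 (λ j → f (suc j)) (λ j → f≡0 (suc j)))

sumFin-single : {m : ℕ} (f : Fin m → ℚ) (i : Fin m) → (∀ j → i ≢ j → f j ≡ 0ℚ) → sumFin f ≡ f i
sumFin-single {suc m} f zero    off = begin
  f zero + sumFin (λ j → f (suc j))  ≡⟨ cong (f zero +_) (sumFin-0 _ (λ j → off (suc j) (λ ()))) ⟩
  f zero + 0ℚ                        ≡⟨ ℚ.+-identityʳ (f zero) ⟩
  f zero                             ∎
  where open ≡-Reasoning
sumFin-single {suc m} f (suc i) off = begin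
  f zero + sumFin (λ j → f (suc j))  ≡⟨ cong₂ _+_ (off zero (λ ()))
                                          (sumFin-single _ i (λ j i≢j → off (suc j) (i≢j ∘ suc-injective))) ⟩
  0ℚ + f (suc i)                     ≡⟨ ℚ.+-identityˡ (f (suc i)) ⟩
  f (suc i)                          ∎
  where open ≡-Reasoning

⟨eᵢ,x⟩≡xᵢ : {m : ℕ} (i : Fin m) (x : Pt m) → ⟨ e i , x ⟩ ≡ x i
⟨eᵢ,x⟩≡xᵢ i x = trans (sumFin-single _ i off) diag
  where
  off : ∀ j → i ≢ j → e i j * x j ≡ 0ℚ
  off j i≢j with i ≟ j
  ... | yes i≡j = contradiction i≡j i≢j
  ... | no _    = ℚ.*-zeroˡ (x j)
  diag : e i i * x i ≡ x i
  diag with i ≟ i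
  ... | yes _  = ℚ.*-identityˡ (x i)
  ... | no i≢i = contradiction refl i≢i

+-cancelʳ-≤ : (r : ℚ) {p q : ℚ} → p + r ≤ q + r → p ≤ q
+-cancelʳ-≤ r {p} {q} p+r≤q+r = subst₂ _≤_ (cancel p) (cancel q) (ℚ.+-monoˡ-≤ (- r) p+r≤q+r)
  where
  cancel : ∀ u → u + r + - r ≡ u
  cancel u = trans (ℚ.+-assoc u r (- r)) (trans (cong (u +_) (ℚ.+-inverseʳ r)) (ℚ.+-identityʳ u))

+-≤-tight : {a b c d : ℚ} → a ≤ c → b ≤ d → a + b ≡ c + d → a ≡ c × b ≡ d
+-≤-tight {a} {b} {c} {d} a≤c b≤d a+b≡c+d =
  tightˡ a≤c b≤d a+b≡c+d , tightˡ b≤d a≤c (trans (ℚ.+-comm b a) (trans a+b≡c+d (ℚ.+-comm c d)))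
  where
  tightˡ : {a b c d : ℚ} → a ≤ c → b ≤ d → a + b ≡ c + d → a ≡ c
  tightˡ {a} {b} {c} {d} a≤c b≤d a+b≡c+d =
    ℚ.≤-antisym a≤c (+-cancelʳ-≤ d (subst (_≤ a + d) a+b≡c+d (ℚ.+-monoʳ-≤ a b≤d)))

p≤r⇒p-q≤r : {p q r : ℚ} → 0ℚ ≤ q → p ≤ r → p - q ≤ r
p≤r⇒p-q≤r {p} 0≤q p≤r =
  ℚ.≤-trans (subst (p - _ ≤_) (ℚ.+-identityʳ p) (ℚ.+-monoʳ-≤ p (ℚ.neg-antimono-≤ 0≤q))) p≤r

r≤p-q⇒q≡0×p≡r : {p q r : ℚ} → 0ℚ ≤ q → p ≤ r → r ≤ p - q → q ≡ 0ℚ × p ≡ r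
r≤p-q⇒q≡0×p≡r {p} {q} {r} 0≤q p≤r r≤p-q = ℚ.neg-injective (proj₂ tight) , proj₁ tight
  where
  tight : p ≡ r × - q ≡ 0ℚ
  tight = +-≤-tight p≤r (ℚ.neg-antimono-≤ 0≤q)
            (trans (ℚ.≤-antisym (p≤r⇒p-q≤r 0≤q p≤r) r≤p-q) (sym (ℚ.+-identityʳ r)))

0≤1 : 0ℚ ≤ 1ℚ
0≤1 = ℚ.≤ᵇ⇒≤ _

data Comb {m : ℕ} : List (Pt m) → Pt m → ℚ → Set where
  []  : {x : Pt m} → (∀ j → x j ≡ 0ℚ) → Comb [] x 0ℚ
  add : {p : Pt m} {ps : List (Pt m)} {x y : Pt m} {s : ℚ} (t : ℚ) → 0ℚ ≤ t → t ≤ 1ℚ →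
        Comb ps y s → (∀ j → x j ≡ t * p j + y j) → Comb (p ∷ ps) x (t + s)

InZonotope : {m : ℕ} → List (Pt m) → Pt m → Set
InZonotope ps x = Σ[ s ∈ ℚ ] Comb ps x s

module _ {m : ℕ} where

  lengthℚ : List (Pt m) → ℚ
  lengthℚ []       = 0ℚ
  lengthℚ (_ ∷ ps) = 1ℚ + lengthℚ ps

  sumᵥ : List (Pt m) → Pt m
  sumᵥ []       j = 0ℚ
  sumᵥ (p ∷ ps) j = p j + sumᵥ ps j

  Comb-resp : {ps : List (Pt m)} {x y : Pt m} {s : ℚ} → x ≗ y → Comb ps x s → Comb ps y s
  Comb-resp x≗y ([] x≡0)            = [] (λ j → trans (sym (x≗y j)) (x≡0 j))
  Comb-resp x≗y (add t lo hi c x≡) = add t lo hi c (λ j → trans (sym (x≗y j)) (x≡ j))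

  Comb-↭ : {ps qs : List (Pt m)} {x : Pt m} {s : ℚ} → ps ↭ qs → Comb ps x s → Comb qs x s
  Comb-↭ ↭.refl               c                   = c
  Comb-↭ (prep p ps↭qs)      (add t lo hi c x≡) = add t lo hi (Comb-↭ ps↭qs c) x≡
  Comb-↭ (swap p q ps↭qs) (add {x = x} t lo hi (add t′ lo′ hi′ c y≡) x≡) =
    subst (Comb _ x) (x∙yz≈y∙xz t′ t _)
      (add t′ lo′ hi′ (add t lo hi (Comb-↭ ps↭qs c) (λ j → refl))
        (λ j → trans (x≡ j) (trans (cong (t * p j +_) (y≡ j)) (x∙yz≈y∙xz (t * p j) (t′ * q j) _))))
  Comb-↭ (↭.trans ps↭qs qs↭rs) c                   = Comb-↭ qs↭rs (Comb-↭ ps↭qs c)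

  Comb-++⁺ : {ps qs : List (Pt m)} {x y : Pt m} {s r : ℚ} →
    Comb ps x s → Comb qs y r → Comb (ps ++ qs) (λ j → x j + y j) (s + r)
  Comb-++⁺ {y = y} {r = r} ([] x≡0) c′ =
    subst (Comb _ _) (sym (ℚ.+-identityˡ r))
      (Comb-resp (λ j → trans (sym (ℚ.+-identityˡ (y j))) (cong (_+ y j) (sym (x≡0 j)))) c′)
  Comb-++⁺ {y = y} {r = r} (add {p = p} {y = x′} {s = s} t lo hi c x≡) c′ =
    subst (Comb _ _) (sym (ℚ.+-assoc t s r))
      (add t lo hi (Comb-++⁺ c c′) (λ j → trans (cong (_+ y j) (x≡ j)) (ℚ.+-assoc (t * p j) (x′ j) (y j))))

  Comb-++⁻ : (ps : List (Pt m)) {qs : List (Pt m)} {x : Pt m} {s : ℚ} → Comb (ps ++ qs) x s →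
    Σ[ y ∈ Pt m ] Σ[ r ∈ ℚ ] Σ[ y′ ∈ Pt m ] Σ[ r′ ∈ ℚ ]
      Comb ps y r × Comb qs y′ r′ × (∀ j → x j ≡ y j + y′ j)
  Comb-++⁻ []       {x = x} {s} c =
    (λ _ → 0ℚ) , 0ℚ , x , s , [] (λ _ → refl) , c , λ j → sym (ℚ.+-identityˡ (x j))
  Comb-++⁻ (p ∷ ps) (add t lo hi c x≡) with Comb-++⁻ ps c
  ... | y , r , y′ , r′ , cy , cy′ , eq =
    (λ j → t * p j + y j) , t + r , y′ , r′ , add t lo hi cy (λ j → refl) , cy′ ,
    λ j → trans (x≡ j) (trans (cong (t * p j +_) (eq j)) (sym (ℚ.+-assoc (t * p j) (y j) (y′ j))))

  Comb-weight-nonNeg : {ps : List (Pt m)} {x : Pt m} {s : ℚ} → Comb ps x s → 0ℚ ≤ s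
  Comb-weight-nonNeg ([] _)             = ℚ.≤-refl
  Comb-weight-nonNeg (add t lo hi c _) = ℚ.+-mono-≤ lo (Comb-weight-nonNeg c)

  Comb-weight-≤ : {ps : List (Pt m)} {x : Pt m} {s : ℚ} → Comb ps x s → s ≤ lengthℚ ps
  Comb-weight-≤ ([] _)             = ℚ.≤-refl
  Comb-weight-≤ (add t lo hi c _) = ℚ.+-mono-≤ hi (Comb-weight-≤ c)

  Comb-weight-0 : {ps : List (Pt m)} {x : Pt m} {s : ℚ} → Comb ps x s → s ≡ 0ℚ → ∀ j → x j ≡ 0ℚ
  Comb-weight-0 ([] x≡0)                                   _   j = x≡0 j
  Comb-weight-0 (add {p = p} {x = x} {y = y} t lo hi c x≡) s≡0 j with +-≤-tight lo (Comb-weight-nonNeg c) (sym s≡0)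
  ... | 0≡t , 0≡s′ = begin
    x j              ≡⟨ x≡ j ⟩
    t * p j + y j    ≡⟨ cong₂ (λ u v → u * p j + v) (sym 0≡t) (Comb-weight-0 c (sym 0≡s′) j) ⟩
    0ℚ * p j + 0ℚ    ≡⟨ cong (_+ 0ℚ) (ℚ.*-zeroˡ (p j)) ⟩
    0ℚ               ∎
    where open ≡-Reasoning

  Comb-weight-max : {ps : List (Pt m)} {x : Pt m} {s : ℚ} → Comb ps x s → s ≡ lengthℚ ps →
    ∀ j → x j ≡ sumᵥ ps j
  Comb-weight-max ([] x≡0)                                   _     j = x≡0 j
  Comb-weight-max (add {p = p} {x = x} {y = y} t lo hi c x≡) s≡max j with +-≤-tight hi (Comb-weight-≤ c) s≡max
  ... | t≡1 , s′≡max = begin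
    x j              ≡⟨ x≡ j ⟩
    t * p j + y j    ≡⟨ cong₂ (λ u v → u * p j + v) t≡1 (Comb-weight-max c s′≡max j) ⟩
    1ℚ * p j + _     ≡⟨ cong (_+ _) (ℚ.*-identityˡ (p j)) ⟩
    p j + _          ∎
    where open ≡-Reasoning

  Comb-origin : (ps : List (Pt m)) → Comb ps (λ _ → 0ℚ) 0ℚ
  Comb-origin []       = [] (λ _ → refl)
  Comb-origin (p ∷ ps) = add 0ℚ ℚ.≤-refl 0≤1 (Comb-origin ps) (λ j → sym (cong (_+ 0ℚ) (ℚ.*-zeroˡ (p j))))

  Comb-sum : (ps : List (Pt m)) → Comb ps (sumᵥ ps) (lengthℚ ps)
  Comb-sum []       = [] (λ _ → refl)
  Comb-sum (p ∷ ps) = add 1ℚ 0≤1 ℚ.≤-refl (Comb-sum ps) (λ j → cong (_+ sumᵥ ps j) (sym (ℚ.*-identityˡ (p j))))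

module _ {a b : ℚ} (0≤a : 0ℚ ≤ a) (0≤b : 0ℚ ≤ b) (a+b≡1 : a + b ≡ 1ℚ) where

  private
    mix : ℚ → ℚ → ℚ
    mix u v = a * u + b * v

    instance
      a-nonNeg : NonNegative a
      a-nonNeg = nonNegative 0≤a
      b-nonNeg : NonNegative b
      b-nonNeg = nonNegative 0≤b

    mix-nonNeg : {u v : ℚ} → 0ℚ ≤ u → 0ℚ ≤ v → 0ℚ ≤ mix u v
    mix-nonNeg 0≤u 0≤v = subst₂ (λ l r → l + r ≤ mix _ _) (ℚ.*-zeroʳ a) (ℚ.*-zeroʳ b)
      (ℚ.+-mono-≤ (ℚ.*-monoˡ-≤-nonNeg a 0≤u) (ℚ.*-monoˡ-≤-nonNeg b 0≤v))

    mix-≤1 : {u v : ℚ} → u ≤ 1ℚ → v ≤ 1ℚ → mix u v ≤ 1ℚ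
    mix-≤1 u≤1 v≤1 = subst (mix _ _ ≤_) (trans (cong₂ _+_ (ℚ.*-identityʳ a) (ℚ.*-identityʳ b)) a+b≡1)
      (ℚ.+-mono-≤ (ℚ.*-monoˡ-≤-nonNeg a u≤1) (ℚ.*-monoˡ-≤-nonNeg b v≤1))

    mix-zero : mix 0ℚ 0ℚ ≡ 0ℚ
    mix-zero = cong₂ _+_ (ℚ.*-zeroʳ a) (ℚ.*-zeroʳ b)

    mix-affine : (t t′ p u v : ℚ) → mix (t * p + u) (t′ * p + v) ≡ mix t t′ * p + mix u v
    mix-affine = solve 7 (λ a b t t′ p u v → a :* (t :* p :+ u) :+ b :* (t′ :* p :+ v)
                            := (a :* t :+ b :* t′) :* p :+ (a :* u :+ b :* v)) refl a b

    mix-+ : (t t′ s r : ℚ) → mix (t + s) (t′ + r) ≡ mix t t′ + mix s r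
    mix-+ = solve 6 (λ a b t t′ s r → a :* (t :+ s) :+ b :* (t′ :+ r)
                       := (a :* t :+ b :* t′) :+ (a :* s :+ b :* r)) refl a b

  Comb-convex : {m : ℕ} {ps : List (Pt m)} {x y : Pt m} {s r : ℚ} → Comb ps x s → Comb ps y r →
    Comb ps (λ j → a * x j + b * y j) (a * s + b * r)
  Comb-convex ([] x≡0) ([] y≡0) =
    subst (Comb [] _) (sym mix-zero) ([] (λ j → trans (cong₂ mix (x≡0 j) (y≡0 j)) mix-zero))
  Comb-convex (add {p = p} {y = x′} {s = s} t lo hi c x≡) (add {y = y′} {s = r} t′ lo′ hi′ c′ y≡) =
    subst (Comb _ _) (sym (mix-+ t t′ s r))
      (add (mix t t′) (mix-nonNeg lo lo′) (mix-≤1 hi hi′) (Comb-convex c c′)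
        (λ j → trans (cong₂ mix (x≡ j) (y≡ j)) (mix-affine t t′ (p j) (x′ j) (y′ j))))

module _ {n : ℕ} (i : Fin (suc n)) (c : ℚ) where

  private
    distrib : (t s : ℚ) → c * (t + s) ≡ t * c + c * s
    distrib t s = trans (ℚ.*-distribˡ-+ c t s) (cong (_+ c * s) (ℚ.*-comm c t))

  Comb-insertAt⁻ : {ps : List (Pt (suc n))} {qs : List (Pt n)} {x : Pt (suc n)} {s : ℚ} →
    Pointwise (λ p q → p ≗ insertAt q i c) ps qs → Comb ps x s → x i ≡ c * s × Comb qs (removeAt x i) s
  Comb-insertAt⁻ [] ([] x≡0) = trans (x≡0 i) (sym (ℚ.*-zeroʳ c)) , [] (λ k → x≡0 (punchIn i k))
  Comb-insertAt⁻ (_∷_ {x = p} {y = q} p≗ ps≈qs) (add {x = x} {y = y} {s = s} t lo hi cmb x≡)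
    with Comb-insertAt⁻ ps≈qs cmb
  ... | yᵢ≡cs , cmb′ = at-i , add t lo hi cmb′ off-i
    where
    at-i : x i ≡ c * (t + s)
    at-i = begin
      x i             ≡⟨ x≡ i ⟩
      t * p i + y i   ≡⟨ cong₂ (λ u v → t * u + v) (trans (p≗ i) (insertAt-lookup q i c)) yᵢ≡cs ⟩
      t * c + c * s   ≡⟨ distrib t s ⟨
      c * (t + s)     ∎
      where open ≡-Reasoning
    off-i : ∀ k → x (punchIn i k) ≡ t * q k + y (punchIn i k)
    off-i k = trans (x≡ (punchIn i k)) (cong (λ u → t * u + _) (trans (p≗ (punchIn i k)) (insertAt-punchIn q i c k)))

  Comb-insertAt⁺ : {ps : List (Pt (suc n))} {qs : List (Pt n)} {y : Pt n} {s : ℚ} →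
    Pointwise (λ p q → p ≗ insertAt q i c) ps qs → Comb qs y s → Comb ps (insertAt y i (c * s)) s
  Comb-insertAt⁺ {y = y} [] ([] y≡0) =
    [] (≗-by-punchIn i (trans (insertAt-lookup y i (c * 0ℚ)) (ℚ.*-zeroʳ c))
                       (λ k → trans (insertAt-punchIn y i (c * 0ℚ) k) (y≡0 k)))
  Comb-insertAt⁺ {y = y} (_∷_ {x = p} {y = q} p≗ ps≈qs) (add {y = y′} {s = s} t lo hi cmb y≡) =
    add t lo hi (Comb-insertAt⁺ ps≈qs cmb) (≗-by-punchIn i at-i off-i)
    where
    at-i : insertAt y i (c * (t + s)) i ≡ t * p i + insertAt y′ i (c * s) i
    at-i = begin
      insertAt y i (c * (t + s)) i   ≡⟨ insertAt-lookup y i _ ⟩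
      c * (t + s)                    ≡⟨ distrib t s ⟩
      t * c + c * s                  ≡⟨ cong₂ (λ u v → t * u + v) (trans (p≗ i) (insertAt-lookup q i c))
                                                                  (insertAt-lookup y′ i _) ⟨
      t * p i + insertAt y′ i (c * s) i ∎
      where open ≡-Reasoning
    off-i : ∀ k → insertAt y i (c * (t + s)) (punchIn i k) ≡ t * p (punchIn i k) + insertAt y′ i (c * s) (punchIn i k)
    off-i k = begin
      insertAt y i _ (punchIn i k)   ≡⟨ insertAt-punchIn y i _ k ⟩
      y k                            ≡⟨ y≡ k ⟩
      t * q k + y′ k                 ≡⟨ cong₂ (λ u v → t * u + v) (trans (p≗ (punchIn i k)) (insertAt-punchIn q i c k))
                                                                  (insertAt-punchIn y′ i _ k) ⟨
      t * p (punchIn i k) + insertAt y′ i (c * s) (punchIn i k) ∎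
      where open ≡-Reasoning

module _ {A : Set} {m : ℕ} (f : A → Pt m) where

  coeffs→Comb : (L : List A) {x : Pt m} (t : Fin (length L) → ℚ) →
    (∀ k → 0ℚ ≤ t k × t k ≤ 1ℚ) → (∀ j → x j ≡ sumFin (λ k → t k * f (lookup L k) j)) →
    Comb (map f L) x (sumFin t)
  coeffs→Comb []      t bounds x≡ = [] x≡
  coeffs→Comb (a ∷ L) t bounds x≡ =
    add (t zero) (proj₁ (bounds zero)) (proj₂ (bounds zero))
      (coeffs→Comb L (λ k → t (suc k)) (λ k → bounds (suc k)) (λ j → refl)) x≡

  Comb→coeffs : (L : List A) {x : Pt m} {s : ℚ} → Comb (map f L) x s →
    Σ[ t ∈ (Fin (length L) → ℚ) ]
      (∀ k → 0ℚ ≤ t k × t k ≤ 1ℚ) × (∀ j → x j ≡ sumFin (λ k → t k * f (lookup L k) j))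
  Comb→coeffs []      ([] x≡0) = (λ ()) , (λ ()) , x≡0
  Comb→coeffs (a ∷ L) (add {y = y} t lo hi c x≡) with Comb→coeffs L c
  ... | t′ , bounds , y≡ = coeff , bounds′ , λ j → trans (x≡ j) (cong (t * f a j +_) (y≡ j))
    where
    coeff : Fin (suc (length L)) → ℚ
    coeff zero    = t
    coeff (suc k) = t′ k
    bounds′ : ∀ k → 0ℚ ≤ coeff k × coeff k ≤ 1ℚ
    bounds′ zero    = lo , hi
    bounds′ (suc k) = bounds k

module _ {A : Set} {m : ℕ} (f : A → Pt m) (P : A → Bool)
         (dropped≡0 : ∀ a → P a ≡ false → ∀ j → f a j ≡ 0ℚ) where

  Comb-filter⁺ : (L : List A) {x : Pt m} {s : ℚ} → Comb (map f (filterᵇ P L)) x s → Comb (map f L) x s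
  Comb-filter⁺ []      c = c
  Comb-filter⁺ (a ∷ L) c with P a in Pa
  Comb-filter⁺ (a ∷ L) (add t lo hi c x≡) | true  = add t lo hi (Comb-filter⁺ L c) x≡
  Comb-filter⁺ (a ∷ L) {x} {s} c          | false =
    subst (Comb _ x) (ℚ.+-identityˡ s)
      (add 0ℚ ℚ.≤-refl 0≤1 (Comb-filter⁺ L c)
        (λ j → sym (trans (cong (_+ x j) (ℚ.*-zeroˡ (f a j))) (ℚ.+-identityˡ (x j)))))

  Comb-filter⁻ : (L : List A) {x : Pt m} {s : ℚ} → Comb (map f L) x s → Σ[ r ∈ ℚ ] Comb (map f (filterᵇ P L)) x r
  Comb-filter⁻ []      c = _ , c
  Comb-filter⁻ (a ∷ L) (add {x = x} {y = y} t lo hi c x≡) with P a in Pa | Comb-filter⁻ L c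
  ... | true  | r , c′ = t + r , add t lo hi c′ x≡
  ... | false | r , c′ = r , Comb-resp x≗y c′
    where
    x≗y : y ≗ x
    x≗y j = sym (begin
      x j            ≡⟨ x≡ j ⟩
      t * f a j + y j ≡⟨ cong (λ u → t * u + y j) (dropped≡0 a Pa j) ⟩
      t * 0ℚ + y j    ≡⟨ cong (_+ y j) (ℚ.*-zeroʳ t) ⟩
      0ℚ + y j        ≡⟨ ℚ.+-identityˡ (y j) ⟩
      y j             ∎)
      where open ≡-Reasoning

module _ {A B : Set} where

  concatMap⁺ : {f g : A → List B} → (∀ a → f a ↭ g a) → (xs : List A) → concatMap f xs ↭ concatMap g xs
  concatMap⁺ f↭g []       = ↭-refl
  concatMap⁺ f↭g (a ∷ xs) = ++⁺ (f↭g a) (concatMap⁺ f↭g xs)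

  concatMap-++-↭ : (f g : A → List B) (xs : List A) →
    concatMap (λ a → f a ++ g a) xs ↭ concatMap f xs ++ concatMap g xs
  concatMap-++-↭ f g []       = ↭-refl
  concatMap-++-↭ f g (a ∷ xs) = begin
    (f a ++ g a) ++ concatMap (λ a → f a ++ g a) xs    ↭⟨ ++⁺ˡ (f a ++ g a) (concatMap-++-↭ f g xs) ⟩
    (f a ++ g a) ++ (concatMap f xs ++ concatMap g xs) ≡⟨ List.++-assoc (f a) (g a) _ ⟩
    f a ++ (g a ++ (concatMap f xs ++ concatMap g xs)) ↭⟨ ++⁺ˡ (f a) (shifts (g a) (concatMap f xs)) ⟩
    f a ++ (concatMap f xs ++ (g a ++ concatMap g xs)) ≡⟨ List.++-assoc (f a) _ _ ⟨
    (f a ++ concatMap f xs) ++ (g a ++ concatMap g xs) ∎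
    where open PermutationReasoning

concatMap-comm : {A B C : Set} (f : A → B → List C) (xs : List A) (ys : List B) →
  concatMap (λ a → concatMap (f a) ys) xs ↭ concatMap (λ b → concatMap (λ a → f a b) xs) ys
concatMap-comm f []       ys = ↭-reflexive (sym (concatMap-[] ys))
  where
  concatMap-[] : (ys : List _) → concatMap (λ _ → []) ys ≡ []
  concatMap-[] []       = refl
  concatMap-[] (_ ∷ ys) = concatMap-[] ys
concatMap-comm f (a ∷ xs) ys = ↭-trans (++⁺ˡ (concatMap (f a) ys) (concatMap-comm f xs ys))
  (↭-sym (concatMap-++-↭ (f a) (λ b → concatMap (λ a → f a b) xs) ys))

toPt : {m : ℕ} → (Fin m → Tri) → Pt m
toPt ε j = val (ε j)

-- Built from `cons` rather than `insertAt`, so that `allTri (suc n)` is literally the case i = zero.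
ins : {n : ℕ} → Fin (suc n) → Tri → (Fin n → Tri) → Fin (suc n) → Tri
ins zero          t ε = cons t ε
ins {suc n} (suc i) t ε = cons (ε zero) (ins i t (λ j → ε (suc j)))

toPt-ins : {n : ℕ} (i : Fin (suc n)) (t : Tri) (ε : Fin n → Tri) → toPt (ins i t ε) ≗ insertAt (toPt ε) i (val t)
toPt-ins zero          t ε zero    = refl
toPt-ins zero          t ε (suc j) = refl
toPt-ins {suc n} (suc i) t ε zero    = refl
toPt-ins {suc n} (suc i) t ε (suc j) = toPt-ins i t (λ k → ε (suc k)) j

tris : List Tri
tris = neg ∷ zer ∷ pos ∷ []

allTri-↭-ins : {n : ℕ} (i : Fin (suc n)) → allTri (suc n) ↭ concatMap (λ t → map (ins i t) (allTri n)) tris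
allTri-↭-ins zero            = ↭-refl
allTri-↭-ins {suc n} (suc i) = begin
  concatMap (λ s → map (cons s) (allTri (suc n))) tris
    ↭⟨ concatMap⁺ (λ s → map⁺ (cons s) (allTri-↭-ins i)) tris ⟩
  concatMap (λ s → map (cons s) (concatMap (λ t → map (ins i t) A) tris)) tris
    ≡⟨ List.concatMap-cong (λ s → map-concatMap-map (cons s) (λ t → ins i t)) tris ⟩
  concatMap (λ s → concatMap (λ t → map (cons s ∘ ins i t) A) tris) tris
    ↭⟨ concatMap-comm (λ s t → map (cons s ∘ ins i t) A) tris tris ⟩
  concatMap (λ t → concatMap (λ s → map (cons s ∘ ins i t) A) tris) tris
    ≡⟨ List.concatMap-cong (λ t → map-concatMap-map (ins (suc i) t) cons) tris ⟨
  concatMap (λ t → map (ins (suc i) t) (allTri (suc n))) tris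
    ∎
  where
  open PermutationReasoning
  A : List (Fin n → Tri)
  A = allTri n
  map-concatMap-map : (g : (Fin _ → Tri) → Fin _ → Tri) (h : Tri → (Fin _ → Tri) → Fin _ → Tri) →
    map g (concatMap (λ t → map (h t) A) tris) ≡ concatMap (λ t → map (g ∘ h t) A) tris
  map-concatMap-map g h = trans (List.map-concatMap g (λ t → map (h t) A) tris)
    (List.concatMap-cong (λ t → sym (List.map-∘ {g = g} {f = h t} A)) tris)

signVectors : (m : ℕ) → List (Pt m)
signVectors m = map toPt (allTri m)

toPt-allZero : {m : ℕ} (ε : Fin m → Tri) → anyNonzero ε ≡ false → ∀ j → toPt ε j ≡ 0ℚ
toPt-allZero {suc m} ε none j with ε zero in ε₀≡
toPt-allZero {suc m} ε none zero    | zer = cong val ε₀≡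
toPt-allZero {suc m} ε none (suc j) | zer = toPt-allZero (λ k → ε (suc k)) none j

-- Z_m only sums over ε ≠ 0; the zero generator changes the weights but not the set.
InZ⇔InZonotope : {m : ℕ} {x : Pt m} → InZ m x ⇔ InZonotope (signVectors m) x
InZ⇔InZonotope {m} = mk⇔
  (λ (t , bounds , x≡) →
    _ , Comb-filter⁺ toPt anyNonzero toPt-allZero (allTri m) (coeffs→Comb toPt (gens m) t bounds x≡))
  (λ (s , c) → Comb→coeffs toPt (gens m) (proj₂ (Comb-filter⁻ toPt anyNonzero toPt-allZero (allTri m) c)))

module SignSplitting {n : ℕ} (i : Fin (suc n)) where

  signBlock : Tri → List (Pt (suc n))
  signBlock t = map toPt (map (ins i t) (allTri n))

  signBlock-inserts : (t : Tri) → Pointwise (λ p q → p ≗ insertAt q i (val t)) (signBlock t) (signVectors n)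
  signBlock-inserts t = go (allTri n)
    where
    go : (L : List (Fin n → Tri)) →
      Pointwise (λ p q → p ≗ insertAt q i (val t)) (map toPt (map (ins i t) L)) (map toPt L)
    go []      = []
    go (ε ∷ L) = toPt-ins i t ε ∷ go L

  signVectors-↭ : signVectors (suc n) ↭ signBlock neg ++ signBlock zer ++ signBlock pos ++ []
  signVectors-↭ = ↭-trans (map⁺ toPt (allTri-↭-ins i))
    (↭-reflexive (List.map-concatMap toPt (λ t → map (ins i t) (allTri n)) tris))

  record SignSplit (x : Pt (suc n)) : Set where
    field
      y₋ y₀ y₊ : Pt n
      s₋ s₀ s₊ : ℚ
      comb₋    : Comb (signVectors n) y₋ s₋
      comb₀    : Comb (signVectors n) y₀ s₀
      comb₊    : Comb (signVectors n) y₊ s₊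
      value-at-i  : x i ≡ s₊ - s₋
      value-off-i : ∀ k → x (punchIn i k) ≡ y₋ k + y₀ k + y₊ k

  private
    sign-weights : (a b c : ℚ) → val neg * a + (val zer * b + val pos * c) ≡ c - a
    sign-weights = solve 3 (λ a b c → con (- 1ℚ) :* a :+ (con 0ℚ :* b :+ con 1ℚ :* c) := c :- a) refl

    lower : (t : Tri) {x : Pt (suc n)} {s : ℚ} → Comb (signBlock t) x s →
      x i ≡ val t * s × Comb (signVectors n) (removeAt x i) s
    lower t = Comb-insertAt⁻ i (val t) (signBlock-inserts t)

    lift : (t : Tri) {y : Pt n} {s : ℚ} → Comb (signVectors n) y s → Comb (signBlock t) (insertAt y i (val t * s)) s
    lift t = Comb-insertAt⁺ i (val t) (signBlock-inserts t)

  split : {x : Pt (suc n)} → InZonotope (signVectors (suc n)) x → SignSplit x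
  split {x} (_ , c) with Comb-++⁻ (signBlock neg) (Comb-↭ signVectors-↭ c)
  ... | x₋ , s₋ , _ , _ , c₋ , c₀₊ , x≡ with Comb-++⁻ (signBlock zer) c₀₊
  ... | x₀ , s₀ , _ , _ , c₀ , c₊ , x₀₊≡ with Comb-++⁻ (signBlock pos) c₊
  ... | x₊ , s₊ , _ , _ , c₊′ , [] r≡0 , x₊≡ with lower neg c₋ | lower zer c₀ | lower pos c₊′
  ... | x₋ᵢ≡ , comb₋ | x₀ᵢ≡ , comb₀ | x₊ᵢ≡ , comb₊ = record
    { comb₋       = comb₋
    ; comb₀       = comb₀
    ; comb₊       = comb₊
    ; value-at-i  = trans (x-sum i) (trans (cong₂ _+_ x₋ᵢ≡ (cong₂ _+_ x₀ᵢ≡ x₊ᵢ≡)) (sign-weights s₋ s₀ s₊))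
    ; value-off-i = λ k → let j = punchIn i k in trans (x-sum j) (sym (ℚ.+-assoc (x₋ j) (x₀ j) (x₊ j)))
    }
    where
    x-sum : ∀ j → x j ≡ x₋ j + (x₀ j + x₊ j)
    x-sum j = trans (x≡ j) (cong (x₋ j +_) (trans (x₀₊≡ j) (cong (x₀ j +_)
                (trans (x₊≡ j) (trans (cong (x₊ j +_) (r≡0 j)) (ℚ.+-identityʳ (x₊ j)))))))

  unsplit : {x : Pt (suc n)} → SignSplit x → InZonotope (signVectors (suc n)) x
  unsplit {x} σ = _ , Comb-↭ (↭-sym signVectors-↭) (Comb-resp (≗-by-punchIn i at-i off-i)
      (Comb-++⁺ (lift neg comb₋) (Comb-++⁺ (lift zer comb₀) (Comb-++⁺ (lift pos comb₊) (Comb-origin [])))))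
    where
    open SignSplit σ
    x₋ x₀ x₊ : Pt (suc n)
    x₋ = insertAt y₋ i (val neg * s₋)
    x₀ = insertAt y₀ i (val zer * s₀)
    x₊ = insertAt y₊ i (val pos * s₊)
    drop-0 : ∀ j → x₋ j + (x₀ j + (x₊ j + 0ℚ)) ≡ x₋ j + (x₀ j + x₊ j)
    drop-0 j = cong (λ u → x₋ j + (x₀ j + u)) (ℚ.+-identityʳ (x₊ j))
    at-i : x₋ i + (x₀ i + (x₊ i + 0ℚ)) ≡ x i
    at-i = begin
      x₋ i + (x₀ i + (x₊ i + 0ℚ))                          ≡⟨ drop-0 i ⟩
      x₋ i + (x₀ i + x₊ i)                                 ≡⟨ cong₂ _+_ (insertAt-lookup y₋ i _)
                                                             (cong₂ _+_ (insertAt-lookup y₀ i _) (insertAt-lookup y₊ i _)) ⟩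
      val neg * s₋ + (val zer * s₀ + val pos * s₊)         ≡⟨ sign-weights s₋ s₀ s₊ ⟩
      s₊ - s₋                                              ≡⟨ value-at-i ⟨
      x i                                                  ∎
      where open ≡-Reasoning
    off-i : ∀ k → x₋ (punchIn i k) + (x₀ (punchIn i k) + (x₊ (punchIn i k) + 0ℚ)) ≡ x (punchIn i k)
    off-i k = begin
      x₋ (punchIn i k) + (x₀ (punchIn i k) + (x₊ (punchIn i k) + 0ℚ)) ≡⟨ drop-0 (punchIn i k) ⟩
      x₋ (punchIn i k) + (x₀ (punchIn i k) + x₊ (punchIn i k))        ≡⟨ cong₂ _+_ (insertAt-punchIn y₋ i _ k)
                                                                          (cong₂ _+_ (insertAt-punchIn y₀ i _ k) (insertAt-punchIn y₊ i _ k)) ⟩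
      y₋ k + (y₀ k + y₊ k)                                            ≡⟨ ℚ.+-assoc (y₋ k) (y₀ k) (y₊ k) ⟨
      y₋ k + y₀ k + y₊ k                                              ≡⟨ value-off-i k ⟨
      x (punchIn i k)                                                 ∎
      where open ≡-Reasoning

module _ {n : ℕ} (i : Fin (suc n)) where

  open SignSplitting i

  maxWeight : ℚ
  maxWeight = lengthℚ (signVectors n)

  -- signSum is in fact 0 by symmetry; nothing below needs that.
  signSum : Pt n
  signSum = sumᵥ (signVectors n)

  apex : Pt (suc n)
  apex = insertAt signSum i maxWeight

  InZ-coord-≤ : {x : Pt (suc n)} → InZ (suc n) x → x i ≤ maxWeight
  InZ-coord-≤ x∈Z =
    subst (_≤ maxWeight) (sym value-at-i) (p≤r⇒p-q≤r (Comb-weight-nonNeg comb₋) (Comb-weight-≤ comb₊))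
    where open SignSplit (split (Equivalence.to InZ⇔InZonotope x∈Z))

  apex+Z′⊆Z : {z : Pt (suc n)} {y : Pt n} {s : ℚ} → Comb (signVectors n) y s →
    z i ≡ maxWeight → (∀ k → z (punchIn i k) ≡ signSum k + y k) → InZ (suc n) z
  apex+Z′⊆Z {z} {y} {s} c zᵢ≡M off = Equivalence.from InZ⇔InZonotope (unsplit record
    { y₋ = λ _ → 0ℚ ; y₀ = y ; y₊ = signSum ; s₋ = 0ℚ ; s₀ = s ; s₊ = maxWeight
    ; comb₋ = Comb-origin _ ; comb₀ = c ; comb₊ = Comb-sum _
    ; value-at-i  = trans zᵢ≡M (sym (ℚ.+-identityʳ maxWeight))
    ; value-off-i = λ k → trans (off k) (rearrange (signSum k) (y k))
    })
    where
    rearrange : (u v : ℚ) → u + v ≡ 0ℚ + v + u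
    rearrange = solve 2 (λ u v → u :+ v := con 0ℚ :+ v :+ u) refl

  apex-InZ : InZ (suc n) apex
  apex-InZ = apex+Z′⊆Z (Comb-origin _) (insertAt-lookup signSum i maxWeight)
    (λ k → trans (insertAt-punchIn signSum i maxWeight k) (sym (ℚ.+-identityʳ _)))

  InTranslatedZ′ : Pt (suc n) → Pt (suc n) → Set
  InTranslatedZ′ v z = Σ[ z′ ∈ Pt (suc n) ] (InZ' i z′ × (∀ j → z j ≡ v j + z′ j))

  InScaledZ′ : ℚ → Pt (suc n) → Set
  InScaledZ′ c z = Σ[ z′ ∈ Pt (suc n) ] (InZ' i z′ × (∀ j → z j ≡ c * z′ j))

  face⇔ : {z : Pt (suc n)} → InFace i z ⇔ InTranslatedZ′ apex z
  face⇔ {z} = mk⇔ to from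
    where
    to : InFace i z → InTranslatedZ′ apex z
    to (z∈Z , maximal) =
      embed i y₀ , (y₀ , Equivalence.from InZ⇔InZonotope (s₀ , comb₀) , λ j → refl) , ≗-by-punchIn i at-i off-i
      where
      open SignSplit (split (Equivalence.to InZ⇔InZonotope z∈Z))
      M≤s₊-s₋ : maxWeight ≤ s₊ - s₋
      M≤s₊-s₋ = subst₂ _≤_ (trans (⟨eᵢ,x⟩≡xᵢ i apex) (insertAt-lookup signSum i maxWeight))
                        (trans (⟨eᵢ,x⟩≡xᵢ i z) value-at-i) (maximal apex apex-InZ)
      tight : s₋ ≡ 0ℚ × s₊ ≡ maxWeight
      tight = r≤p-q⇒q≡0×p≡r (Comb-weight-nonNeg comb₋) (Comb-weight-≤ comb₊) M≤s₊-s₋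
      at-i : z i ≡ apex i + embed i y₀ i
      at-i = begin
        z i                      ≡⟨ value-at-i ⟩
        s₊ - s₋                  ≡⟨ cong₂ _-_ (proj₂ tight) (proj₁ tight) ⟩
        maxWeight + 0ℚ           ≡⟨ cong₂ _+_ (insertAt-lookup signSum i maxWeight) (embed-lookup i y₀) ⟨
        apex i + embed i y₀ i    ∎
        where open ≡-Reasoning
      off-i : ∀ k → z (punchIn i k) ≡ apex (punchIn i k) + embed i y₀ (punchIn i k)
      off-i k = begin
        z (punchIn i k)                   ≡⟨ value-off-i k ⟩
        y₋ k + y₀ k + y₊ k                ≡⟨ cong₂ (λ u v → u + y₀ k + v) (Comb-weight-0 comb₋ (proj₁ tight) k)
                                                                        (Comb-weight-max comb₊ (proj₂ tight) k) ⟩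
        0ℚ + y₀ k + signSum k             ≡⟨ rearrange (y₀ k) (signSum k) ⟩
        signSum k + y₀ k                  ≡⟨ cong₂ _+_ (insertAt-punchIn signSum i maxWeight k)
                                                       (embed-punchIn i y₀ k) ⟨
        apex (punchIn i k) + embed i y₀ (punchIn i k) ∎
        where
        open ≡-Reasoning
        rearrange : (u v : ℚ) → 0ℚ + u + v ≡ v + u
        rearrange = solve 2 (λ u v → con 0ℚ :+ u :+ v := v :+ u) refl
    from : InTranslatedZ′ apex z → InFace i z
    from (z′ , (y , y∈Z , z′≡) , z≡) = z∈Z , maximal
      where
      zᵢ≡M : z i ≡ maxWeight
      zᵢ≡M = trans (z≡ i) (trans (cong₂ _+_ (insertAt-lookup signSum i maxWeight) (trans (z′≡ i) (embed-lookup i y)))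
                                 (ℚ.+-identityʳ maxWeight))
      z∈Z : InZ (suc n) z
      z∈Z = apex+Z′⊆Z (proj₂ (Equivalence.to InZ⇔InZonotope y∈Z)) zᵢ≡M
        (λ k → trans (z≡ (punchIn i k)) (cong₂ _+_ (insertAt-punchIn signSum i maxWeight k)
                                                   (trans (z′≡ (punchIn i k)) (embed-punchIn i y k))))
      maximal : (x : Pt (suc n)) → InZ (suc n) x → ⟨ e i , x ⟩ ≤ ⟨ e i , z ⟩
      maximal x x∈Z =
        subst₂ _≤_ (sym (⟨eᵢ,x⟩≡xᵢ i x)) (sym (trans (⟨eᵢ,x⟩≡xᵢ i z) zᵢ≡M)) (InZ-coord-≤ x∈Z)

  section⇔ : {z : Pt (suc n)} → InSection i z ⇔ InScaledZ′ three z
  section⇔ {z} = mk⇔ to from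
    where
    to : InSection i z → InScaledZ′ three z
    to (z∈Z , ⟨eᵢ,z⟩≡0) = embed i w , (w , w∈Z , λ j → refl) , ≗-by-punchIn i at-i off-i
      where
      open SignSplit (split (Equivalence.to InZ⇔InZonotope z∈Z))
      ⅓ ⅔ ½ : ℚ
      ⅓ = ℤ.+ 1 / 3
      ⅔ = ℤ.+ 2 / 3
      ½ = ℤ.+ 1 / 2
      w : Pt n
      w k = ⅓ * y₋ k + ⅔ * (½ * y₀ k + ½ * y₊ k)
      w∈Z : InZ n w
      w∈Z = Equivalence.from InZ⇔InZonotope
        (_ , Comb-convex (ℚ.≤ᵇ⇒≤ _) (ℚ.≤ᵇ⇒≤ _) refl comb₋
               (Comb-convex (ℚ.≤ᵇ⇒≤ _) (ℚ.≤ᵇ⇒≤ _) refl comb₀ comb₊))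
      at-i : z i ≡ three * embed i w i
      at-i = begin
        z i                 ≡⟨ ⟨eᵢ,x⟩≡xᵢ i z ⟨
        ⟨ e i , z ⟩         ≡⟨ ⟨eᵢ,z⟩≡0 ⟩
        three * 0ℚ          ≡⟨ cong (three *_) (embed-lookup i w) ⟨
        three * embed i w i ∎
        where open ≡-Reasoning
      off-i : ∀ k → z (punchIn i k) ≡ three * embed i w (punchIn i k)
      off-i k = begin
        z (punchIn i k)                  ≡⟨ value-off-i k ⟩
        y₋ k + y₀ k + y₊ k               ≡⟨ thrice-mean (y₋ k) (y₀ k) (y₊ k) ⟩
        three * w k                      ≡⟨ cong (three *_) (embed-punchIn i w k) ⟨
        three * embed i w (punchIn i k)  ∎
        where
        open ≡-Reasoning
        thrice-mean : (a b c : ℚ) → a + b + c ≡ three * (⅓ * a + ⅔ * (½ * b + ½ * c))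
        thrice-mean = solve 3 (λ a b c → a :+ b :+ c
                                 := con three :* (con ⅓ :* a :+ con ⅔ :* (con ½ :* b :+ con ½ :* c))) refl
    from : InScaledZ′ three z → InSection i z
    from (z′ , (w , w∈Z , z′≡) , z≡) = z∈Z , trans (⟨eᵢ,x⟩≡xᵢ i z) zᵢ≡0
      where
      zᵢ≡0 : z i ≡ 0ℚ
      zᵢ≡0 = trans (z≡ i) (trans (cong (three *_) (trans (z′≡ i) (embed-lookup i w))) (ℚ.*-zeroʳ three))
      z∈Z : InZ (suc n) z
      z∈Z with Equivalence.to InZ⇔InZonotope w∈Z
      ... | s , c = Equivalence.from InZ⇔InZonotope (unsplit record
        { y₋ = w ; y₀ = w ; y₊ = w ; s₋ = s ; s₀ = s ; s₊ = s ; comb₋ = c ; comb₀ = c ; comb₊ = c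
        ; value-at-i  = trans zᵢ≡0 (sym (ℚ.+-inverseʳ s))
        ; value-off-i = λ k → let j = punchIn i k in
            trans (z≡ j) (trans (cong (three *_) (trans (z′≡ j) (embed-punchIn i w k))) (triple (w k)))
        })
        where
        triple : (a : ℚ) → three * a ≡ a + a + a
        triple = solve 1 (λ a → con three :* a := a :+ a :+ a) refl

proposition1 : (k : ℕ) → (i : Fin (suc (suc k))) →
    (Σ (Pt (suc (suc k))) λ v → (z : Pt (suc (suc k))) →
      InFace i z ⇔ Σ (Pt (suc (suc k))) λ z' → InZ' i z' × ((j : Fin (suc (suc k))) → z j ≡ v j + z' j))
    ×
    ((z : Pt (suc (suc k))) →
      InSection i z ⇔ Σ (Pt (suc (suc k))) λ z' → InZ' i z' × ((j : Fin (suc (suc k))) → z j ≡ three * z' j))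
proposition1 k i = (apex i , λ z → face⇔ i) , λ z → section⇔ i
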